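{- Let $\mathcal{N}$ be an $n$-normalized family. Then there are pairwise distinct elements $a_1,\dots,a_n\in U(\mathcal{N})$ such that, for each $1\le i\le n$, $a_i$ belongs to at least $i$ members of $\mathcal{N}$.
   Context: $U(\mathcal{N})$ is the union of the members of $\mathcal{N}$. $\mathcal{N}$ is $n$-normalized if it is union-closed, separating (for distinct $a,b\in U(\mathcal{N})$ some $O\in\mathcal{N}$ has $|O\cap\{a,b\}|=1$), $\emptyset\in\mathcal{N}$, $|U(\mathcal{N})|=n$ and $|\mathcal{N}|=n+1$. -}

module Defs where

open import Data.Nat using (ℕ; suc; _≤_)
open import Data.Fin using (Fin; toℕ)
open import Data.Fin.Subset using (Subset; _∈_; _∉_; _∪_; ⊥; ∣_∣)
open import Data.List using (List; foldr; length; filter)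
open import Data.List.Relation.Unary.Unique.Propositional using (Unique)
import Data.List.Membership.Propositional as LM
open import Data.Fin.Subset.Properties using (_∈?_)
open import Data.Product using (Σ; _×_; ∃)
open import Data.Sum using (_⊎_)
open import Relation.Binary.PropositionalEquality using (_≡_; _≢_)
open import Function.Definitions using (Injective)

-- A family of subsets of an ambient finite ground set Fin m, given as a
-- duplicate-free list of subsets (so it represents a finite set of sets).

U : ∀ {m} → List (Subset m) → Subset m
U = foldr _∪_ ⊥

UnionClosed : ∀ {m} → List (Subset m) → Set
UnionClosed 𝒩 = ∀ {A B} → A LM.∈ 𝒩 → B LM.∈ 𝒩 → (A ∪ B) LM.∈ 𝒩

Separating : ∀ {m} → List (Subset m) → Set
Separating {m} 𝒩 = ∀ (a b : Fin m) → a ∈ U 𝒩 → b ∈ U 𝒩 → a ≢ b →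
  ∃ λ O → O LM.∈ 𝒩 × ((a ∈ O × b ∉ O) ⊎ (a ∉ O × b ∈ O))

record Normalized (n : ℕ) {m : ℕ} (𝒩 : List (Subset m)) : Set where
  field
    unique       : Unique 𝒩
    unionClosed  : UnionClosed 𝒩
    separating   : Separating 𝒩
    emptyMember  : ⊥ LM.∈ 𝒩
    sizeUnion    : ∣ U 𝒩 ∣ ≡ n
    sizeFamily   : length 𝒩 ≡ suc n

degree : ∀ {m} → List (Subset m) → Fin m → ℕ
degree 𝒩 a = length (filter (a ∈?_) 𝒩)

-- Let M x be the union of the members of 𝒩 avoiding x; by union-closure it is the largest
-- member not containing x, and separation gives x ∈ M y or y ∈ M x for distinct x, y ∈ U 𝒩.
-- Rank the points of U 𝒩 by ∣ M x ∣. If y ≠ x is ranked at least as high as x, then x ∈ M y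
-- (otherwise M y ⊂ M x), and the sets M y are pairwise distinct and differ from U 𝒩. So a point
-- dominated by k others lies in at least k + 1 members, and listing the n points by decreasing
-- rank gives the required a₁, …, aₙ.

module Submission where

open import Defs
open import Data.Nat using (ℕ; zero; suc; _+_; _≤_; z≤n; s≤s; s≤s⁻¹)
open import Data.Nat.Properties using (≤-trans; ≤-reflexive; +-suc; <⇒≱; module ≤-Reasoning)
open import Data.Fin as Fin using (Fin; zero; suc; toℕ)
open import Data.Fin.Properties using (0≢1+n; suc-injective)
open import Data.List using (List; []; _∷_; length; filter; map)
open import Data.List.Properties using (length-map)
open import Data.List.Membership.Propositional using () renaming (_∈_ to _∈ₗ_)
open import Data.List.Membership.Propositional.Properties using (∈-filter⁺; ∈-filter⁻; ∈-map⁻)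
open import Data.List.Relation.Unary.Any using (here; there)
open import Data.List.Relation.Unary.All as All using (All; []; _∷_)
import Data.List.Relation.Unary.All.Properties as All
open import Data.List.Relation.Unary.AllPairs using ([]; _∷_)
open import Data.List.Relation.Unary.Unique.Propositional using (Unique)
import Data.List.Relation.Unary.Unique.Propositional.Properties as Unique
open import Data.Vec using ([]; _∷_; here; there)
open import Data.Vec.Functional as Vector using (Vector)
open import Data.Vec.Properties using (≡-dec)
import Data.Bool.Properties as Bool
open import Data.Product using (Σ; ∃; _×_; _,_; proj₁; proj₂)
open import Data.Sum using (_⊎_; inj₁; inj₂)
open import Function.Base using (id; _∘_)
open import Function.Definitions using (Injective)
open import Relation.Nullary using (¬?; yes; no; contradiction)
open import Relation.Binary.Definitions using (DecidableEquality)
open import Relation.Binary.PropositionalEquality using (_≡_; _≢_; refl; sym; trans; cong; subst)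

injective-∷ : ∀ {A : Set} {k} {x : A} {a : Vector A k} →
  (∀ i → a i ≢ x) → Injective _≡_ _≡_ a → Injective _≡_ _≡_ (x Vector.∷ a)
injective-∷ a≢x inj {zero}  {zero}  _  = refl
injective-∷ a≢x inj {zero}  {suc j} eq = contradiction (sym eq) (a≢x j)
injective-∷ a≢x inj {suc i} {zero}  eq = contradiction eq (a≢x i)
injective-∷ a≢x inj {suc i} {suc j} eq = cong suc (inj eq)

module WithDecidableEquality {A : Set} (_≟_ : DecidableEquality A) where

  open import Data.List.Properties using (filter-notAll)
  open import Data.List.Membership.Propositional using (_∈_; _∉_)
  open import Data.List.Relation.Binary.Subset.Propositional using (_⊆_)
  open import Data.List.Relation.Unary.Any as Any using ()
  open import Data.List.Extrema.Nat using (argmax; argmax-sel; f[⊥]≤f[argmax]; f[xs]≤f[argmax])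

  remove : A → List A → List A
  remove x = filter (λ y → ¬? (y ≟ x))

  ∈-remove⁺ : ∀ {x y xs} → y ∈ xs → y ≢ x → y ∈ remove x xs
  ∈-remove⁺ = ∈-filter⁺ (λ y → ¬? (y ≟ _))

  ∈-remove⁻ : ∀ {x y} xs → y ∈ remove x xs → y ∈ xs × y ≢ x
  ∈-remove⁻ xs = ∈-filter⁻ (λ y → ¬? (y ≟ _)) {xs = xs}

  remove-unique : ∀ {x xs} → Unique xs → Unique (remove x xs)
  remove-unique {x} = Unique.filter⁺ (λ y → ¬? (y ≟ x))

  length-remove-< : ∀ {x xs} → x ∈ xs → suc (length (remove x xs)) ≤ length xs
  length-remove-< {x} {xs} x∈xs =
    filter-notAll (λ y → ¬? (y ≟ x)) xs (Any.map (λ x≡y y≢x → y≢x (sym x≡y)) x∈xs)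

  length-mono-⊆ : ∀ {xs ys} → Unique xs → xs ⊆ ys → length xs ≤ length ys
  length-mono-⊆ {[]}               _            _     = z≤n
  length-mono-⊆ {x ∷ xs} {ys} (x≢xs ∷ xs!) xs⊆ys =
    ≤-trans (s≤s (length-mono-⊆ xs! xs⊆ys-x)) (length-remove-< (xs⊆ys (here refl)))
    where
    xs⊆ys-x : xs ⊆ remove x ys
    xs⊆ys-x y∈xs = ∈-remove⁺ (xs⊆ys (there y∈xs)) (λ y≡x → All.lookup x≢xs y∈xs (sym y≡x))

  length-remove-≥ : ∀ {x xs} → Unique xs → length xs ≤ suc (length (remove x xs))
  length-remove-≥ {x} {xs} xs! = length-mono-⊆ xs! xs⊆x∷xs-x
    where
    xs⊆x∷xs-x : xs ⊆ x ∷ remove x xs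
    xs⊆x∷xs-x {y} y∈xs with y ≟ x
    ... | yes y≡x = here y≡x
    ... | no  y≢x = there (∈-remove⁺ y∈xs y≢x)

  module _ (rank : A → ℕ) where

    record Dominators (L : List A) (x : A) (K : List A) : Set where
      field
        unique : Unique K
        ⊆L     : K ⊆ L
        x∉K    : x ∉ K
        above  : All (λ y → rank x ≤ rank y) K

    no-dominators : ∀ {L x} → Dominators L x []
    no-dominators = record { unique = [] ; ⊆L = λ () ; x∉K = λ () ; above = [] }

    dominators-∷ : ∀ {L x y K} → x ∈ L → rank y ≤ rank x → y ≢ x →
      Dominators (remove x L) y K → Dominators L y (x ∷ K)
    dominators-∷ {L} {x} {y} {K} x∈L y≤x y≢x D = record
      { unique = All.tabulate x≢K ∷ D.unique
      ; ⊆L     = λ { (here refl) → x∈L ; (there z∈K) → proj₁ (∈-remove⁻ L (D.⊆L z∈K)) }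
      ; x∉K    = λ { (here y≡x) → y≢x y≡x ; (there y∈K) → D.x∉K y∈K }
      ; above  = y≤x ∷ D.above
      }
      where
      module D = Dominators D
      x≢K : ∀ {z} → z ∈ K → x ≢ z
      x≢K z∈K x≡z = proj₂ (∈-remove⁻ L (D.⊆L z∈K)) (sym x≡z)

    Enumeration : (f : A → ℕ) (c k : ℕ) (L : List A) → Set
    Enumeration f c k L = Σ (Vector A k) λ a →
      Injective _≡_ _≡_ a × (∀ i → a i ∈ L) × (∀ i → c + suc (toℕ i) ≤ f (a i))

    -- c counts the elements already taken, each of which dominates every element of L.
    enumerate-by-rank : (f : A → ℕ) (c k : ℕ) {L : List A} → Unique L → k ≤ length L →
      (∀ {x K} → x ∈ L → Dominators L x K → c + suc (length K) ≤ f x) →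
      Enumeration f c k L
    enumerate-by-rank f c zero _ _ _ = (λ ()) , (λ { {()} }) , (λ ()) , (λ ())
    enumerate-by-rank f c (suc k) {z ∷ L₀} L! k<∣L∣ bound =
      x Vector.∷ a , injective-∷ a≢x a-injective , a∈L , a-bound
      where
      L : List A
      L = z ∷ L₀

      x : A
      x = argmax rank z L₀

      L' : List A
      L' = remove x L

      x∈L : x ∈ L
      x∈L with argmax-sel rank z L₀
      ... | inj₁ x≡z  = here x≡z
      ... | inj₂ x∈L₀ = there x∈L₀

      x-maximal : ∀ {y} → y ∈ L → rank y ≤ rank x
      x-maximal = All.lookup (f[⊥]≤f[argmax] {f = rank} z L₀ ∷ f[xs]≤f[argmax] {f = rank} z L₀)

      bound' : ∀ {y K} → y ∈ L' → Dominators L' y K → suc c + suc (length K) ≤ f y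
      bound' {y} {K} y∈L' D with ∈-remove⁻ L y∈L'
      ... | y∈L , y≢x = subst (_≤ f y) (+-suc c (suc (length K)))
                          (bound y∈L (dominators-∷ x∈L (x-maximal y∈L) y≢x D))

      rest : Enumeration f (suc c) k L'
      rest = enumerate-by-rank f (suc c) k (remove-unique L!)
               (s≤s⁻¹ (≤-trans k<∣L∣ (length-remove-≥ {x} L!))) bound'

      a : Vector A k
      a = proj₁ rest

      a-injective : Injective _≡_ _≡_ a
      a-injective = proj₁ (proj₂ rest)

      a∈L' : ∀ i → a i ∈ L'
      a∈L' = proj₁ (proj₂ (proj₂ rest))

      a≢x : ∀ i → a i ≢ x
      a≢x i = proj₂ (∈-remove⁻ L (a∈L' i))

      a∈L : ∀ i → (x Vector.∷ a) i ∈ L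
      a∈L zero    = x∈L
      a∈L (suc i) = proj₁ (∈-remove⁻ L (a∈L' i))

      a-bound : ∀ i → c + suc (toℕ i) ≤ f ((x Vector.∷ a) i)
      a-bound zero    = bound x∈L no-dominators
      a-bound (suc i) = subst (_≤ f (a i)) (sym (+-suc c (suc (toℕ i))))
                          (proj₂ (proj₂ (proj₂ rest)) i)

open WithDecidableEquality using (Dominators; enumerate-by-rank; length-mono-⊆)

open import Data.Fin.Subset using (Subset; _∈_; _∉_; _⊆_; _⊂_; ⊥; ∣_∣; inside; outside)
open import Data.Fin.Subset.Properties using (_∈?_; x∈p∪q⁻; p⊆p∪q; q⊆p∪q; ∉⊥; p⊂q⇒∣p∣<∣q∣)

elements : ∀ {m} → Subset m → List (Fin m)
elements []            = []
elements (inside ∷ p)  = zero ∷ map suc (elements p)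
elements (outside ∷ p) = map suc (elements p)

length-elements : ∀ {m} (p : Subset m) → length (elements p) ≡ ∣ p ∣
length-elements []            = refl
length-elements (inside ∷ p)  = cong suc (trans (length-map suc (elements p)) (length-elements p))
length-elements (outside ∷ p) = trans (length-map suc (elements p)) (length-elements p)

∈-elements⁻ : ∀ {m} (p : Subset m) {x} → x ∈ₗ elements p → x ∈ p
∈-elements⁻ (inside ∷ p)  (here refl) = here
∈-elements⁻ (inside ∷ p)  (there x∈)  with ∈-map⁻ suc x∈
... | y , y∈ , refl = there (∈-elements⁻ p y∈)
∈-elements⁻ (outside ∷ p) x∈          with ∈-map⁻ suc x∈
... | y , y∈ , refl = there (∈-elements⁻ p y∈)

elements-unique : ∀ {m} (p : Subset m) → Unique (elements p)
elements-unique []            = []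
elements-unique (inside ∷ p)  =
  All.map⁺ (All.universal (λ _ → 0≢1+n) (elements p)) ∷ Unique.map⁺ suc-injective (elements-unique p)
elements-unique (outside ∷ p) = Unique.map⁺ suc-injective (elements-unique p)

∈-U⁻ : ∀ {m} {x : Fin m} (Ss : List (Subset m)) → x ∈ U Ss → ∃ λ S → S ∈ₗ Ss × x ∈ S
∈-U⁻ []       x∈ = contradiction x∈ ∉⊥
∈-U⁻ (S ∷ Ss) x∈ with x∈p∪q⁻ S (U Ss) x∈
... | inj₁ x∈S  = S , here refl , x∈S
... | inj₂ x∈Ss with ∈-U⁻ Ss x∈Ss
...   | T , T∈Ss , x∈T = T , there T∈Ss , x∈T

⊆-U : ∀ {m} {S : Subset m} {Ss} → S ∈ₗ Ss → S ⊆ U Ss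
⊆-U {Ss = S ∷ Ss} (here refl) = p⊆p∪q (U Ss)
⊆-U {Ss = T ∷ Ss} (there S∈)  = q⊆p∪q T (U Ss) ∘ ⊆-U S∈

U-∈ : ∀ {m} {𝒩 : List (Subset m)} → UnionClosed 𝒩 → ⊥ ∈ₗ 𝒩 →
  ∀ Ss → (∀ {S} → S ∈ₗ Ss → S ∈ₗ 𝒩) → U Ss ∈ₗ 𝒩
U-∈ closed ⊥∈ []       _    = ⊥∈
U-∈ closed ⊥∈ (S ∷ Ss) Ss⊆𝒩 = closed (Ss⊆𝒩 (here refl)) (U-∈ closed ⊥∈ Ss (Ss⊆𝒩 ∘ there))

module _ {n m : ℕ} {𝒩 : List (Subset m)} (𝒩-normalized : Normalized n 𝒩) where

  open Normalized 𝒩-normalized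

  largestWithout : Fin m → Subset m
  largestWithout x = U (filter (λ S → ¬? (x ∈? S)) 𝒩)

  U∈𝒩 : U 𝒩 ∈ₗ 𝒩
  U∈𝒩 = U-∈ unionClosed emptyMember 𝒩 id

  largestWithout∈𝒩 : ∀ x → largestWithout x ∈ₗ 𝒩
  largestWithout∈𝒩 x =
    U-∈ unionClosed emptyMember _ (proj₁ ∘ ∈-filter⁻ (λ S → ¬? (x ∈? S)) {xs = 𝒩})

  x∉largestWithout : ∀ x → x ∉ largestWithout x
  x∉largestWithout x x∈ with ∈-U⁻ (filter (λ S → ¬? (x ∈? S)) 𝒩) x∈
  ... | S , S∈ , x∈S = proj₂ (∈-filter⁻ (λ S → ¬? (x ∈? S)) {xs = 𝒩} S∈) x∈S

  ⊆largestWithout : ∀ {x S} → S ∈ₗ 𝒩 → x ∉ S → S ⊆ largestWithout x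
  ⊆largestWithout {x} S∈𝒩 x∉S = ⊆-U (∈-filter⁺ (λ S → ¬? (x ∈? S)) S∈𝒩 x∉S)

  largestWithout-separates : ∀ {x y} → x ∈ U 𝒩 → y ∈ U 𝒩 → x ≢ y →
    x ∈ largestWithout y ⊎ y ∈ largestWithout x
  largestWithout-separates {x} {y} x∈U y∈U x≢y with separating x y x∈U y∈U x≢y
  ... | O , O∈𝒩 , inj₁ (x∈O , y∉O) = inj₁ (⊆largestWithout O∈𝒩 y∉O x∈O)
  ... | O , O∈𝒩 , inj₂ (x∉O , y∈O) = inj₂ (⊆largestWithout O∈𝒩 x∉O y∈O)

  largestWithout-injective : ∀ {x y} → x ∈ U 𝒩 → y ∈ U 𝒩 → x ≢ y →
    largestWithout x ≢ largestWithout y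
  largestWithout-injective {x} {y} x∈U y∈U x≢y Mx≡My with largestWithout-separates x∈U y∈U x≢y
  ... | inj₁ x∈My = x∉largestWithout x (subst (x ∈_) (sym Mx≡My) x∈My)
  ... | inj₂ y∈Mx = x∉largestWithout y (subst (y ∈_) Mx≡My y∈Mx)

  U≢largestWithout : ∀ {y} → y ∈ U 𝒩 → U 𝒩 ≢ largestWithout y
  U≢largestWithout {y} y∈U U≡My = x∉largestWithout y (subst (y ∈_) U≡My y∈U)

  largestWithout-unique : ∀ {K} → Unique K → All (_∈ U 𝒩) K → Unique (map largestWithout K)
  largestWithout-unique []          []          = []
  largestWithout-unique (y≢K ∷ K!) (y∈U ∷ K⊆U) =
    All.map⁺ (All.zipWith (λ (y≢z , z∈U) → largestWithout-injective y∈U z∈U y≢z) (y≢K , K⊆U))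
    ∷ largestWithout-unique K! K⊆U

  rank : Fin m → ℕ
  rank x = ∣ largestWithout x ∣

  -- Otherwise largestWithout y ⊆ largestWithout x, and separation puts y in the difference.
  rank≤⇒∈largestWithout : ∀ {x y} → x ∈ U 𝒩 → y ∈ U 𝒩 → x ≢ y → rank x ≤ rank y →
    x ∈ largestWithout y
  rank≤⇒∈largestWithout {x} {y} x∈U y∈U x≢y rx≤ry
    with x ∈? largestWithout y | largestWithout-separates x∈U y∈U x≢y
  ... | yes x∈My | _         = x∈My
  ... | no  x∉My | inj₁ x∈My = contradiction x∈My x∉My
  ... | no  x∉My | inj₂ y∈Mx = contradiction rx≤ry (<⇒≱ (p⊂q⇒∣p∣<∣q∣ My⊂Mx))
    where
    My⊂Mx : largestWithout y ⊂ largestWithout x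
    My⊂Mx = ⊆largestWithout (largestWithout∈𝒩 y) x∉My , y , y∈Mx , x∉largestWithout y

  dominators<degree : ∀ {x K} → x ∈ U 𝒩 →
    Dominators Fin._≟_ rank (elements (U 𝒩)) x K → suc (length K) ≤ degree 𝒩 x
  dominators<degree {x} {K} x∈U D = begin
      suc (length K)       ≡⟨ cong suc (length-map largestWithout K) ⟨
      length witnesses     ≤⟨ length-mono-⊆ (≡-dec Bool._≟_) witnesses-unique witnesses∋x ⟩
      degree 𝒩 x           ∎
    where
    open ≤-Reasoning
    module D = Dominators D
    witnesses : List (Subset m)
    witnesses = U 𝒩 ∷ map largestWithout K

    K⊆U : All (_∈ U 𝒩) K
    K⊆U = All.tabulate (∈-elements⁻ (U 𝒩) ∘ D.⊆L)

    witnesses-unique : Unique witnesses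
    witnesses-unique = All.map⁺ (All.map U≢largestWithout K⊆U) ∷ largestWithout-unique D.unique K⊆U

    witnesses∋x : ∀ {S} → S ∈ₗ witnesses → S ∈ₗ filter (x ∈?_) 𝒩
    witnesses∋x (here refl) = ∈-filter⁺ (x ∈?_) U∈𝒩 x∈U
    witnesses∋x (there S∈)  with ∈-map⁻ largestWithout S∈
    ... | y , y∈K , refl = ∈-filter⁺ (x ∈?_) (largestWithout∈𝒩 y)
            (rank≤⇒∈largestWithout x∈U (All.lookup K⊆U y∈K) x≢y (All.lookup D.above y∈K))
      where
      x≢y : x ≢ y
      x≢y refl = D.x∉K y∈K

corollary4p12 : (n m : ℕ) (𝒩 : List (Subset m)) → Normalized n 𝒩 →
    Σ (Fin n → Fin m) λ a →
    Injective _≡_ _≡_ a × (∀ i → a i ∈ U 𝒩) × (∀ i → suc (toℕ i) ≤ degree 𝒩 (a i))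
corollary4p12 n m 𝒩 𝒩-normalized =
  let a , a-injective , a∈elements , a-bound =
        enumerate-by-rank Fin._≟_ (rank 𝒩-normalized) (degree 𝒩) 0 n (elements-unique (U 𝒩)) n≤∣U∣
          (λ x∈U → dominators<degree 𝒩-normalized (∈-elements⁻ (U 𝒩) x∈U))
  in  a , a-injective , ∈-elements⁻ (U 𝒩) ∘ a∈elements , a-bound
  where
  n≤∣U∣ : n ≤ length (elements (U 𝒩))
  n≤∣U∣ = ≤-reflexive (sym (trans (length-elements (U 𝒩)) (Normalized.sizeUnion 𝒩-normalized)))
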